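{- Let $p$, $q$, $r$ be $\mathrm{BPA}^*_{01}$ expressions with $p\cdot q^*\to^* r$. Then either there exists $p'$ such that $p\to^* p'$ and $r=p'\cdot q^*$, or there exist $p'$ and $q'$ such that $p\to^* p'$, $p'\downarrow$, $q\to^* q'$, and $r=q'\cdot q^*$.
   Context: Fix a non-empty set $A$ of actions. $\mathrm{BPA}^*_{01}$ expressions are generated by $p ::= \mathbf{0} \mid \mathbf{1} \mid a \mid p\cdot p \mid p+p \mid p^*$ with $a\in A$ (equality is syntactic identity). The transition relation $p\xrightarrow{a}p'$ and termination predicate $p\downarrow$ are the least relations such that: $\mathbf{1}\downarrow$; $a\xrightarrow{a}\mathbf{1}$; if $p\xrightarrow{a}p'$ then $p+q\xrightarrow{a}p'$ and $q+p\xrightarrow{a}p'$; if $p\downarrow$ then $(p+q)\downarrow$ and $(q+p)\downarrow$; if $p\xrightarrow{a}p'$ then $p\cdot q\xrightarrow{a}p'\cdot q$; if $p\downarrow$ and $q\xrightarrow{a}q'$ then $p\cdot q\xrightarrow{a}q'$; if $p\downarrow$ and $q\downarrow$ then $(p\cdot q)\downarrow$; if $p\xrightarrow{a}p'$ then $p^*\xrightarrow{a}p'\cdot p^*$; $p^*\downarrow$. $p\to q$ means $p\xrightarrow{a}q$ for some $a$, and $\to^*$ is its reflexive-transitive closure. -}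

module Defs where

open import Relation.Binary.Construct.Closure.ReflexiveTransitive using (Star)

module BPA (A : Set) where

  infixl 7 _·_
  infixl 6 _+_

  data Exp : Set where
    𝟘   : Exp
    𝟙   : Exp
    act : A → Exp
    _·_ : Exp → Exp → Exp
    _+_ : Exp → Exp → Exp
    _*  : Exp → Exp

  mutual
    data _↓ : Exp → Set where
      𝟙↓   : 𝟙 ↓
      +↓ˡ  : ∀ {p q} → p ↓ → (p + q) ↓
      +↓ʳ  : ∀ {p q} → p ↓ → (q + p) ↓
      ·↓   : ∀ {p q} → p ↓ → q ↓ → (p · q) ↓
      *↓   : ∀ {p} → (p *) ↓

    data _─[_]→_ : Exp → A → Exp → Set where
      act→  : ∀ {a} → act a ─[ a ]→ 𝟙
      +→ˡ   : ∀ {p q a p'} → p ─[ a ]→ p' → (p + q) ─[ a ]→ p'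
      +→ʳ   : ∀ {p q a p'} → p ─[ a ]→ p' → (q + p) ─[ a ]→ p'
      ·→ˡ   : ∀ {p q a p'} → p ─[ a ]→ p' → (p · q) ─[ a ]→ (p' · q)
      ·→ʳ   : ∀ {p q a q'} → p ↓ → q ─[ a ]→ q' → (p · q) ─[ a ]→ q'
      *→    : ∀ {p a p'} → p ─[ a ]→ p' → (p *) ─[ a ]→ (p' · (p *))

  data _⟶_ : Exp → Exp → Set where
    step : ∀ {p q} (a : A) → p ─[ a ]→ q → p ⟶ q

  _⟶*_ : Exp → Exp → Set
  _⟶*_ = Star _⟶_

module Submission where

open import Defs
open import Data.Product using (Σ; _×_; _,_)
open import Data.Sum using (_⊎_; inj₁; inj₂)
open import Relation.Binary.PropositionalEquality using (_≡_; refl)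
open import Relation.Binary.Construct.Closure.ReflexiveTransitive using (ε; _◅_; _◅◅_)

-- Both shapes are closed under a single step: a step of
-- p' · q* either moves p', or p' terminates and q* unfolds to q'' · q* for a
-- step q → q''.

module Reachability (A : Set) where
  open BPA A

  InLeftPhase : Exp → Exp → Exp → Set
  InLeftPhase p q r = Σ Exp λ p' → (p ⟶* p') × (r ≡ p' · (q *))

  InLoopPhase : Exp → Exp → Exp → Set
  InLoopPhase p q r =
    Σ Exp λ p' → Σ Exp λ q' → (p ⟶* p') × (p' ↓) × (q ⟶* q') × (r ≡ q' · (q *))

  Reachable-·* : Exp → Exp → Exp → Set
  Reachable-·* p q r = InLeftPhase p q r ⊎ InLoopPhase p q r

  ⟶*-snoc : ∀ {x y z} → x ⟶* y → y ⟶ z → x ⟶* z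
  ⟶*-snoc xs t = xs ◅◅ (t ◅ ε)

  Reachable-·*-step : ∀ {p q r s} → Reachable-·* p q r → r ⟶ s → Reachable-·* p q s
  Reachable-·*-step (inj₁ (p' , p⟶*p' , refl)) (step a (·→ˡ t)) =
    inj₁ (_ , ⟶*-snoc p⟶*p' (step a t) , refl)
  Reachable-·*-step (inj₁ (p' , p⟶*p' , refl)) (step a (·→ʳ p'↓ (*→ t))) =
    inj₂ (p' , _ , p⟶*p' , p'↓ , step a t ◅ ε , refl)
  Reachable-·*-step (inj₂ (p' , q' , p⟶*p' , p'↓ , q⟶*q' , refl)) (step a (·→ˡ t)) =
    inj₂ (p' , _ , p⟶*p' , p'↓ , ⟶*-snoc q⟶*q' (step a t) , refl)
  Reachable-·*-step (inj₂ (p' , q' , p⟶*p' , p'↓ , q⟶*q' , refl)) (step a (·→ʳ _ (*→ t))) =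
    inj₂ (p' , _ , p⟶*p' , p'↓ , step a t ◅ ε , refl)

  Reachable-·*-steps : ∀ {p q r s} → Reachable-·* p q r → r ⟶* s → Reachable-·* p q s
  Reachable-·*-steps reach ε        = reach
  Reachable-·*-steps reach (t ◅ ts) = Reachable-·*-steps (Reachable-·*-step reach t) ts

  Reachable-·*-start : ∀ p q → Reachable-·* p q (p · (q *))
  Reachable-·*-start p q = inj₁ (p , ε , refl)

lemma16 : (A : Set) → A → let open BPA A in
    (p q r : Exp) → (p · (q *)) ⟶* r →
    (Σ Exp λ p' → (p ⟶* p') × (r ≡ p' · (q *)))
    ⊎ (Σ Exp λ p' → Σ Exp λ q' → (p ⟶* p') × (p' ↓) × (q ⟶* q') × (r ≡ q' · (q *)))
lemma16 A _ p q r run = Reachable-·*-steps (Reachable-·*-start p q) run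
  where open Reachability A
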